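{- Let $G=(V,E)$ be a graph, $r \ge 1$, and $\pi$ a permutation of $V$. Let $X$ be the set of vertex pairs whose label the $r$-PIVOT clustering on $\pi$ disagrees with but the PIVOT clustering on $\pi$ agrees with. Then every $\{u,v\}\in X$ is an edge of $G$ and $u$ and $v$ belong to the same PIVOT cluster; letting $p_{\{u,v\}}$ denote the pivot (in PIVOT) of that cluster, one of the following holds after the $r$ rounds of $r$-PIVOT: (i) $p_{\{u,v\}}$ is unsettled; (ii) $p_{\{u,v\}}$ is settled, and at least one of $u,v$ is in a singleton cluster of the $r$-PIVOT output and has an unsettled neighbor $w$ that is not a pivot of PIVOT and satisfies $\pi(w) < \pi(p_{\{u,v\}})$.
   Context: Correlation clustering: for a graph $G=(V,E)$, a clustering is a partition of $V$; a clustering agrees with the label of a pair $\{u,v\}$ if either $\{u,v\}\in E$ and $u,v$ are in the same cluster, or $\{u,v\}\notin E$ and they are in different clusters; otherwise it disagrees. $N(v)$ is the neighborhood of $v$. Algorithm PIVOT on permutation $\pi$: while vertices remain, let $v$ be the remaining vertex of lowest rank, mark it a pivot, form the cluster of $v$ and its remaining neighbors, and remove it. Each PIVOT cluster contains exactly one pivot. Algorithm $r$-PIVOT on permutation $\pi$: initially every vertex is unsettled. For $r$ rounds: every unsettled $v$ with $\pi(v) < \pi(u)$ for all unsettled $u \in N(v)$ is marked a pivot (simultaneously); then all pivots and all vertices adjacent to pivots are marked settled. Afterwards, every pivot starts a cluster containing itself, and each non-pivot $u$: if $N(u)$ contains no pivot, or there is an unsettled $w \in N(u)$ whose rank is smaller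 than all pivots in $N(u)$, then $u$ forms a singleton cluster; otherwise $u$ joins the cluster of the minimum-rank pivot in $N(u)$. "Settled/unsettled" in the claim refers to the status at the end of the $r$ rounds of $r$-PIVOT. -}

module Defs where

open import Data.Nat using (ℕ; zero; suc)
open import Data.Bool using (Bool; true; false; not; _∧_; _∨_; if_then_else_)
open import Data.Fin using (Fin; _<_; _≟_; _<?_)
open import Data.Fin.Permutation using (Permutation′; _⟨$⟩ʳ_; _⟨$⟩ˡ_)
open import Data.List using (List; allFin; map; foldl; findᵇ)
open import Data.Bool.ListAction using (all; any)
open import Data.Maybe using (Maybe; just; nothing)
open import Data.Product using (Σ; _×_; _,_)
open import Data.Sum using (_⊎_; inj₁; inj₂)
open import Relation.Nullary using (¬_; does)
open import Relation.Binary.PropositionalEquality using (_≡_; _≢_)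

record Graph (n : ℕ) : Set where
  field
    adj     : Fin n → Fin n → Bool
    adj-sym : ∀ u v → adj u v ≡ adj v u
    irrefl  : ∀ v → adj v v ≡ false
open Graph public

module _ {n : ℕ} (G : Graph n) (π : Permutation′ n) where

  rank : Fin n → Fin n
  rank v = π ⟨$⟩ʳ v

  byRank : List (Fin n)
  byRank = map (π ⟨$⟩ˡ_) (allFin n)

  _<ʳ_ : Fin n → Fin n → Bool
  u <ʳ v = does (rank u <? rank v)

  eqᵇ : Fin n → Fin n → Bool
  eqᵇ u v = does (u ≟ v)

  -- State: for each vertex, nothing = still remaining,
  -- just p = removed into the cluster of pivot p.
  -- Processing vertices in increasing rank and skipping removed ones
  -- is exactly "repeatedly pick the remaining vertex of lowest rank".
  pivotStep : (Fin n → Maybe (Fin n)) → Fin n → (Fin n → Maybe (Fin n))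
  pivotStep a v with a v
  ... | just _  = a
  ... | nothing = λ u → step u (a u)
    where
    step : Fin n → Maybe (Fin n) → Maybe (Fin n)
    step u (just q) = just q
    step u nothing  = if eqᵇ u v ∨ adj G v u then just v else nothing

  pivotOf : Fin n → Maybe (Fin n)
  pivotOf = foldl pivotStep (λ _ → nothing) byRank

  SamePivot : Fin n → Fin n → Set
  SamePivot u v = Σ (Fin n) λ p → pivotOf u ≡ just p × pivotOf v ≡ just p

  IsPivotP : Fin n → Set
  IsPivotP w = pivotOf w ≡ just w

  record RState : Set where
    constructor st
    field
      piv     : Fin n → Bool
      settled : Fin n → Bool
  open RState public

  round : RState → RState
  round (st p s) = st p' s'
    where
    newPiv : Fin n → Bool
    newPiv v = not (s v) ∧
      all (λ u → not (adj G v u ∧ not (s u)) ∨ (v <ʳ u)) (allFin n)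
    p' : Fin n → Bool
    p' v = p v ∨ newPiv v
    s' : Fin n → Bool
    s' v = s v ∨ p' v ∨ any (λ w → adj G v w ∧ p' w) (allFin n)

  rounds : ℕ → RState
  rounds zero    = st (λ _ → false) (λ _ → false)
  rounds (suc r) = round (rounds r)

  module _ (r : ℕ) where
    private
      S = rounds r

    rPiv : Fin n → Bool
    rPiv = piv S

    rSettled : Fin n → Bool
    rSettled = settled S

    -- cluster label in the r-PIVOT output:
    -- inj₁ p = cluster started by pivot p;  inj₂ u = singleton {u}
    rLabel : Fin n → Fin n ⊎ Fin n
    rLabel u with rPiv u
    ... | true  = inj₁ u
    ... | false with findᵇ (λ q → adj G u q ∧ rPiv q) byRank
    ...   | nothing = inj₂ u
    ...   | just m  =
            if any (λ w → adj G u w ∧ not (rSettled w) ∧ (w <ʳ m)) (allFin n)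
            then inj₂ u else inj₁ m

    SameR : Fin n → Fin n → Set
    SameR u v = rLabel u ≡ rLabel v

    SingletonR : Fin n → Set
    SingletonR u = ∀ x → rLabel x ≡ rLabel u → x ≡ u

  Agrees : (Fin n → Fin n → Set) → Fin n → Fin n → Set
  Agrees Same u v = (adj G u v ≡ true × Same u v) ⊎ (adj G u v ≡ false × ¬ Same u v)

module Submission where

-- PIVOT visits the vertices in rank order; the invariant it maintains shows that its pivots are
-- pairwise non-adjacent and that every vertex lies in the cluster of the earliest pivot among
-- itself and its neighbours. By induction on the rounds, every pivot of r-PIVOT is a pivot of
-- PIVOT, so a settled PIVOT pivot is an r-PIVOT pivot (a settled vertex is a pivot or adjacent to
-- one). Hence a vertex joining the r-cluster of m lies in the PIVOT cluster of m, and r-PIVOT never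
-- merges vertices that PIVOT separates. For an edge uv inside the PIVOT cluster of a settled p,
-- p is the earliest r-pivot neighbour of u and of v, so one of them misses the r-cluster of p only
-- by being made a singleton by an unsettled neighbour w preceding p; and w is not a PIVOT pivot,
-- since p is the earliest pivot adjacent to u.

open import Defs
open import Data.Bool using (Bool; true; false; not; _∧_; _∨_; T)
open import Data.Bool.ListAction using (any)
open import Data.Bool.Properties using (T-∧; T-∨; T-≡; T-not-≡; T?)
open import Data.Empty using (⊥-elim)
open import Data.Fin as Fin using (Fin; toℕ; _<_; _≟_)
open import Data.Fin.Permutation using (Permutation′; _⟨$⟩ˡ_; inverseˡ; inverseʳ)
open import Data.Fin.Properties as Fin using (toℕ-injective; toℕ<n)
open import Data.List using (List; []; _∷_; foldl; map; tabulate; allFin; findᵇ)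
open import Data.List.Membership.Propositional using (lose)
open import Data.List.Membership.Propositional.Properties using (∈-allFin)
open import Data.List.Relation.Unary.All using (lookup)
open import Data.List.Relation.Unary.All.Properties using (all⁺)
open import Data.List.Relation.Unary.Any using (satisfied)
open import Data.List.Relation.Unary.Any.Properties using (any⁺; any⁻)
open import Data.Maybe using (Maybe; just; nothing)
open import Data.Maybe.Properties using (just-injective)
open import Data.Nat as ℕ using (ℕ; zero; suc; _+_; _≤_; z≤n)
import Data.Nat.Properties as ℕ
open import Data.Product using (Σ; ∃; _×_; _,_)
open import Data.Sum using (_⊎_; inj₁; inj₂)
open import Data.Sum.Properties using (≡-dec)
open import Function using (_∘_; id)
open import Function.Bundles using (module Equivalence)
open import Relation.Nullary using (¬_; Dec; yes; no)
open import Relation.Nullary.Decidable using (decidable-stable)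
open import Relation.Binary.PropositionalEquality using (_≡_; _≢_; refl; sym; trans; cong; subst)

open Equivalence using (to; from)

¬T⇒T-not : ∀ {b} → ¬ T b → T (not b)
¬T⇒T-not {false} _  = _
¬T⇒T-not {true}  ¬t = ¬t _

T-not⇒¬T : ∀ {b} → T (not b) → ¬ T b
T-not⇒¬T {false} _ ()

nothing≢just : ∀ {A : Set} {x : A} → nothing ≢ just x
nothing≢just ()

module _ {n : ℕ} (G : Graph n) (π : Permutation′ n) where

  _≺_ : Fin n → Fin n → Set
  u ≺ v = rank G π u < rank G π v

  _≼_ : Fin n → Fin n → Set
  u ≼ v = rank G π u Fin.≤ rank G π v

  adj-symᵀ : ∀ {u v} → T (adj G u v) → T (adj G v u)
  adj-symᵀ {u} {v} = subst T (adj-sym G u v)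

  adj-irreflᵀ : ∀ {v} → ¬ T (adj G v v)
  adj-irreflᵀ {v} = subst T (irrefl G v)

  rank-injective : ∀ {u v} → rank G π u ≡ rank G π v → u ≡ v
  rank-injective eq = trans (sym (inverseˡ π)) (trans (cong (π ⟨$⟩ˡ_) eq) (inverseˡ π))

  ≼-antisym : ∀ {u v} → u ≼ v → v ≼ u → u ≡ v
  ≼-antisym u≼v v≼u = rank-injective (Fin.≤-antisym u≼v v≼u)

  ≼∧≢⇒≺ : ∀ {u v} → u ≼ v → u ≢ v → u ≺ v
  ≼∧≢⇒≺ u≼v u≢v = Fin.≤∧≢⇒< u≼v (u≢v ∘ rank-injective)

  <ʳ⇒≺ : ∀ {u v} → T (_<ʳ_ G π u v) → u ≺ v
  <ʳ⇒≺ {u} {v} = ℕ.<ᵇ⇒< (toℕ (rank G π u)) (toℕ (rank G π v))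

  ≺⇒<ʳ : ∀ {u v} → u ≺ v → T (_<ʳ_ G π u v)
  ≺⇒<ʳ = ℕ.<⇒<ᵇ

  rank-skip : ∀ {c v y} → toℕ (rank G π v) ≡ c → c ≤ toℕ (rank G π y) → y ≢ v →
              suc c ≤ toℕ (rank G π y)
  rank-skip rv c≤y y≢v =
    ℕ.≤∧≢⇒< c≤y (λ c≡y → y≢v (rank-injective (toℕ-injective (trans (sym c≡y) (sym rv)))))

  data ByRankFrom : ℕ → List (Fin n) → Set where
    []  : ByRankFrom n []
    _∷_ : ∀ {c v vs} → toℕ (rank G π v) ≡ c → ByRankFrom (suc c) vs → ByRankFrom c (v ∷ vs)

  tabulate-ByRankFrom : ∀ {m c} (h : Fin m → Fin n) → (∀ i → toℕ (h i) ≡ c + toℕ i) → c + m ≡ n →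
                        ByRankFrom c (map (π ⟨$⟩ˡ_) (tabulate h))
  tabulate-ByRankFrom {zero} {c} h _ c+0≡n =
    subst (λ k → ByRankFrom k []) (sym (trans (sym (ℕ.+-identityʳ c)) c+0≡n)) []
  tabulate-ByRankFrom {suc m} {c} h h≡c+ c+m≡n =
    trans (cong toℕ (inverseʳ π)) (trans (h≡c+ Fin.zero) (ℕ.+-identityʳ c))
    ∷ tabulate-ByRankFrom (h ∘ Fin.suc) (λ i → trans (h≡c+ (Fin.suc i)) (ℕ.+-suc c (toℕ i)))
                                        (trans (sym (ℕ.+-suc c m)) c+m≡n)

  byRank-ByRankFrom : ByRankFrom 0 (byRank G π)
  byRank-ByRankFrom = tabulate-ByRankFrom id (λ _ → refl) refl

  findᵇ-just-first : ∀ {c vs m} (f : Fin n → Bool) → ByRankFrom c vs → findᵇ f vs ≡ just m →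
                     T (f m) × (∀ y → T (f y) → c ≤ toℕ (rank G π y) → m ≼ y)
  findᵇ-just-first f (_∷_ {v = v} rv vs) found with f v in fv
  findᵇ-just-first f (rv ∷ vs) refl | true =
    from T-≡ fv , λ y _ c≤y → subst (_≤ _) (sym rv) c≤y
  ... | false =
    let fm , first = findᵇ-just-first f vs found
    in fm , λ y fy c≤y → first y fy (rank-skip rv c≤y (λ { refl → subst T fv fy }))

  findᵇ-nothing-none : ∀ {c vs} (f : Fin n → Bool) → ByRankFrom c vs → findᵇ f vs ≡ nothing →
                       ∀ y → c ≤ toℕ (rank G π y) → ¬ T (f y)
  findᵇ-nothing-none f [] _ y n≤y _ = ℕ.<⇒≱ (toℕ<n (rank G π y)) n≤y
  findᵇ-nothing-none f (_∷_ {v = v} rv vs) none y c≤y with f v in fv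
  ... | false with y ≟ v
  ...   | yes refl = subst T fv
  ...   | no y≢v = findᵇ-nothing-none f vs none y (rank-skip rv c≤y y≢v)

  findᵇ-byRank-just : ∀ {m} (f : Fin n → Bool) → findᵇ f (byRank G π) ≡ just m →
                      T (f m) × (∀ y → T (f y) → m ≼ y)
  findᵇ-byRank-just f found =
    let fm , first = findᵇ-just-first f byRank-ByRankFrom found
    in fm , λ y fy → first y fy z≤n

  findᵇ-byRank-nothing : ∀ (f : Fin n → Bool) → findᵇ f (byRank G π) ≡ nothing → ∀ y → ¬ T (f y)
  findᵇ-byRank-nothing f none y = findᵇ-nothing-none f byRank-ByRankFrom none y z≤n

  Assignment : Set
  Assignment = Fin n → Maybe (Fin n)

  data StepView (a : Assignment) (v u : Fin n) : Maybe (Fin n) → Set where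
    kept   : ∀ {p} → a u ≡ just p → StepView a v u (just p)
    joined : a u ≡ nothing → u ≡ v ⊎ T (adj G v u) → StepView a v u (just v)
    left   : a u ≡ nothing → u ≢ v → ¬ T (adj G v u) → StepView a v u nothing

  stepView : ∀ {a v u m} → a v ≡ nothing → pivotStep G π a v u ≡ m → StepView a v u m
  stepView {a} {v} {u} av refl with a v | av
  ... | nothing | refl with a u in au
  ...   | just p = kept au
  ...   | nothing with u ≟ v | adj G v u in vu
  ...     | yes u≡v | _     = joined au (inj₁ u≡v)
  ...     | no u≢v  | true  = joined au (inj₂ (from T-≡ vu))
  ...     | no u≢v  | false = left au u≢v (subst T vu)

  pivotStep-skip : ∀ {a v x} → a v ≡ just x → pivotStep G π a v ≡ a
  pivotStep-skip {a} {v} av with a v | av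
  ... | just _ | refl = refl

  pivotStep-keeps : ∀ {a v u q} → a v ≡ nothing → a u ≡ just q → pivotStep G π a v u ≡ just q
  pivotStep-keeps {a} {v} {u} av au with pivotStep G π a v u | stepView {a} {v} {u} av refl
  ... | _ | kept au′     = trans (sym au′) au
  ... | _ | joined au′ _ = ⊥-elim (nothing≢just (trans (sym au′) au))
  ... | _ | left au′ _ _ = ⊥-elim (nothing≢just (trans (sym au′) au))

  pivotStep-new : ∀ {a v} → a v ≡ nothing → pivotStep G π a v v ≡ just v
  pivotStep-new {a} {v} av with pivotStep G π a v v | stepView {a} {v} {v} av refl
  ... | _ | kept av′     = ⊥-elim (nothing≢just (trans (sym av) av′))
  ... | _ | joined _ _   = refl
  ... | _ | left _ v≢v _ = ⊥-elim (v≢v refl)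

  -- The state of PIVOT once the vertices of rank below c have been processed.
  record PivotInv (c : ℕ) (a : Assignment) : Set where
    field
      pivot-self      : ∀ {u p} → a u ≡ just p → a p ≡ just p
      pivot-adj       : ∀ {u p} → a u ≡ just p → u ≡ p ⊎ T (adj G p u)
      pivot-early     : ∀ {u p} → a u ≡ just p → toℕ (rank G π p) ℕ.< c
      pivot-≼         : ∀ {u p} → a u ≡ just p → p ≼ u
      pivot-min       : ∀ {u p q} → a u ≡ just p → a q ≡ just q → T (adj G u q) → p ≼ q
      unassigned-late : ∀ {u} → a u ≡ nothing → c ≤ toℕ (rank G π u)
      unassigned-free : ∀ {u q} → a u ≡ nothing → a q ≡ just q → ¬ T (adj G u q)
  open PivotInv

  PivotInv-init : PivotInv 0 (λ _ → nothing)
  PivotInv-init = record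
    { pivot-self = λ () ; pivot-adj = λ () ; pivot-early = λ () ; pivot-≼ = λ ()
    ; pivot-min = λ () ; unassigned-late = λ _ → z≤n ; unassigned-free = λ _ () }

  PivotInv-skip : ∀ {c a v x} → PivotInv c a → toℕ (rank G π v) ≡ c → a v ≡ just x →
                  PivotInv (suc c) a
  PivotInv-skip I rv av = record
    { pivot-self = pivot-self I ; pivot-adj = pivot-adj I ; pivot-≼ = pivot-≼ I
    ; pivot-min = pivot-min I ; unassigned-free = unassigned-free I
    ; pivot-early     = λ au → ℕ.m<n⇒m<1+n (pivot-early I au)
    ; unassigned-late = λ au → rank-skip rv (unassigned-late I au)
                                 (λ { refl → nothing≢just (trans (sym au) av) }) }

  PivotInv-new : ∀ {c a v} → PivotInv c a → toℕ (rank G π v) ≡ c → a v ≡ nothing →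
                 PivotInv (suc c) (pivotStep G π a v)
  PivotInv-new {c} {a} {v} I rv av = record
    { pivot-self = self ; pivot-adj = adjacent ; pivot-early = early ; pivot-≼ = below
    ; pivot-min = min ; unassigned-late = late ; unassigned-free = free }
    where
    a′ : Assignment
    a′ = pivotStep G π a v

    view : ∀ {u m} → a′ u ≡ m → StepView a v u m
    view {u} = stepView {a} {v} {u} av

    self : ∀ {u p} → a′ u ≡ just p → a′ p ≡ just p
    self e with view e
    ... | kept au    = pivotStep-keeps {a} {v} av (pivot-self I au)
    ... | joined _ _ = pivotStep-new {a} {v} av

    adjacent : ∀ {u p} → a′ u ≡ just p → u ≡ p ⊎ T (adj G p u)
    adjacent e with view e
    ... | kept au      = pivot-adj I au
    ... | joined _ u~v = u~v

    early : ∀ {u p} → a′ u ≡ just p → toℕ (rank G π p) ℕ.< suc c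
    early e with view e
    ... | kept au    = ℕ.m<n⇒m<1+n (pivot-early I au)
    ... | joined _ _ = ℕ.s≤s (ℕ.≤-reflexive rv)

    below : ∀ {u p} → a′ u ≡ just p → p ≼ u
    below e with view e
    ... | kept au     = pivot-≼ I au
    ... | joined au _ = subst (_≤ _) (sym rv) (unassigned-late I au)

    min : ∀ {u p q} → a′ u ≡ just p → a′ q ≡ just q → T (adj G u q) → p ≼ q
    min eu eq u~q with view eu | view eq
    ... | kept au     | kept aq    = pivot-min I au aq u~q
    ... | kept au     | joined _ _ = ℕ.<⇒≤ (subst (_ ℕ.<_) (sym rv) (pivot-early I au))
    ... | joined au _ | kept aq    = ⊥-elim (unassigned-free I au aq u~q)
    ... | joined _ _  | joined _ _ = ℕ.≤-refl

    late : ∀ {u} → a′ u ≡ nothing → suc c ≤ toℕ (rank G π u)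
    late e with view e
    ... | left au u≢v _ = rank-skip rv (unassigned-late I au) u≢v

    free : ∀ {u q} → a′ u ≡ nothing → a′ q ≡ just q → ¬ T (adj G u q)
    free eu eq with view eu | view eq
    ... | left au _ _  | kept aq    = unassigned-free I au aq
    ... | left _ _ v≁u | joined _ _ = v≁u ∘ adj-symᵀ

  PivotInv-step : ∀ {c a v} → PivotInv c a → toℕ (rank G π v) ≡ c →
                  PivotInv (suc c) (pivotStep G π a v)
  PivotInv-step {c} {a} {v} I rv = by-cases (a v) refl
    where
    by-cases : ∀ m → a v ≡ m → PivotInv (suc c) (pivotStep G π a v)
    by-cases (just _) av =
      subst (PivotInv (suc c)) (sym (pivotStep-skip av)) (PivotInv-skip I rv av)
    by-cases nothing  av = PivotInv-new I rv av

  PivotInv-foldl : ∀ {c a vs} → ByRankFrom c vs → PivotInv c a →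
                   PivotInv n (foldl (pivotStep G π) a vs)
  PivotInv-foldl []        I = I
  PivotInv-foldl (rv ∷ vs) I = PivotInv-foldl vs (PivotInv-step I rv)

  pivotOf-PivotInv : PivotInv n (pivotOf G π)
  pivotOf-PivotInv = PivotInv-foldl byRank-ByRankFrom PivotInv-init

  pivotOf-total : ∀ u → ∃ λ p → pivotOf G π u ≡ just p
  pivotOf-total u with pivotOf G π u in e
  ... | just p  = p , refl
  ... | nothing = ⊥-elim (ℕ.<⇒≱ (toℕ<n (rank G π u)) (unassigned-late pivotOf-PivotInv e))

  pivotOf-pivot : ∀ {u p} → pivotOf G π u ≡ just p → IsPivotP G π p
  pivotOf-pivot = pivot-self pivotOf-PivotInv

  pivotOf-adj : ∀ {u p} → pivotOf G π u ≡ just p → u ≡ p ⊎ T (adj G p u)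
  pivotOf-adj = pivot-adj pivotOf-PivotInv

  pivotOf-≼ : ∀ {u p} → pivotOf G π u ≡ just p → p ≼ u
  pivotOf-≼ = pivot-≼ pivotOf-PivotInv

  pivotOf-min : ∀ {u p q} → pivotOf G π u ≡ just p → IsPivotP G π q → T (adj G u q) → p ≼ q
  pivotOf-min = pivot-min pivotOf-PivotInv

  pivotOf-adj-≢ : ∀ {u p} → pivotOf G π u ≡ just p → u ≢ p → T (adj G u p)
  pivotOf-adj-≢ e u≢p with pivotOf-adj e
  ... | inj₁ u≡p = ⊥-elim (u≢p u≡p)
  ... | inj₂ p~u = adj-symᵀ p~u

  pivots-independent : ∀ {p q} → IsPivotP G π p → IsPivotP G π q → ¬ T (adj G p q)
  pivots-independent pp pq p~q
    with ≼-antisym (pivotOf-min pp pq p~q) (pivotOf-min pq pp (adj-symᵀ p~q))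
  ... | refl = adj-irreflᵀ p~q

  no-earlier-pivot-neighbour⇒pivot : ∀ {v} →
    (∀ {w} → T (adj G v w) → w ≺ v → ¬ IsPivotP G π w) → IsPivotP G π v
  no-earlier-pivot-neighbour⇒pivot {v} none with pivotOf-total v
  ... | p , e with pivotOf-adj e
  ...   | inj₁ refl = e
  ...   | inj₂ p~v  = ⊥-elim (none (adj-symᵀ p~v) p≺v (pivotOf-pivot e))
    where
    p≢v : p ≢ v
    p≢v refl = adj-irreflᵀ p~v

    p≺v : p ≺ v
    p≺v = ≼∧≢⇒≺ (pivotOf-≼ e) p≢v

  round-piv⁻ : ∀ S {v} → T (piv (round G π S) v) →
    T (piv S v) ⊎ (¬ T (settled S v) × (∀ {u} → T (adj G v u) → ¬ T (settled S u) → v ≺ u))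
  round-piv⁻ S {v} p′ with to T-∨ p′
  ... | inj₁ p     = inj₁ p
  ... | inj₂ fresh =
    let ns , first = to T-∧ fresh
    in inj₂ (T-not⇒¬T ns ,
             λ {u} v~u nsu → <ʳ⇒≺ (unblocked (lookup (all⁺ _ _ first) (∈-allFin u)) v~u nsu))
    where
    unblocked : ∀ {a s l} → T (not (a ∧ not s) ∨ l) → T a → ¬ T s → T l
    unblocked {true} {false} l _ _  = l
    unblocked {true} {true}  _ _ ns = ⊥-elim (ns _)

  round-piv⁺ : ∀ S {v} → T (piv S v) → T (piv (round G π S) v)
  round-piv⁺ S p = from T-∨ (inj₁ p)

  round-settled⁻ : ∀ S {v} → T (settled (round G π S) v) →
    T (settled S v) ⊎ T (piv (round G π S) v) ⊎ ∃ λ w → T (adj G v w) × T (piv (round G π S) w)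
  round-settled⁻ S {v} s′ with to T-∨ s′
  ... | inj₁ s = inj₁ s
  ... | inj₂ s′′ with to T-∨ s′′
  ...   | inj₁ p    = inj₂ (inj₁ p)
  ...   | inj₂ near =
    let w , t = satisfied (any⁻ (λ x → adj G v x ∧ piv (round G π S) x) (allFin n) near)
    in inj₂ (inj₂ (w , to T-∧ t))

  round-piv⇒settled : ∀ S {v} → T (piv (round G π S) v) → T (settled (round G π S) v)
  round-piv⇒settled S {v} p = from (T-∨ {settled S v}) (inj₂ (from T-∨ (inj₁ p)))

  round-near⇒settled : ∀ S {v w} → T (piv (round G π S) w) → T (adj G v w) →
                       T (settled (round G π S) v)
  round-near⇒settled S {v} {w} p v~w =
    from (T-∨ {settled S v}) (inj₂ (from (T-∨ {piv (round G π S) v}) (inj₂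
      (any⁺ (λ x → adj G v x ∧ piv (round G π S) x) (lose (∈-allFin w) (from T-∧ (v~w , p)))))))

  record RoundInv (S : RState G π) : Set where
    field
      piv⇒pivot     : ∀ {v} → T (piv S v) → IsPivotP G π v
      settled⇒near  : ∀ {v} → T (settled S v) → T (piv S v) ⊎ ∃ λ q → T (adj G v q) × T (piv S q)
      piv⇒settled   : ∀ {v} → T (piv S v) → T (settled S v)
      near⇒settled  : ∀ {v q} → T (piv S q) → T (adj G v q) → T (settled S v)
  open RoundInv

  RoundInv-round : ∀ {S} → RoundInv S → RoundInv (round G π S)
  RoundInv-round {S} I = record
    { piv⇒pivot    = new-pivots-are-pivots
    ; settled⇒near = near
    ; piv⇒settled  = round-piv⇒settled S
    ; near⇒settled = round-near⇒settled S }
    where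
    new-pivots-are-pivots : ∀ {v} → T (piv (round G π S) v) → IsPivotP G π v
    new-pivots-are-pivots {v} p′ with round-piv⁻ S p′
    ... | inj₁ p                   = piv⇒pivot I p
    ... | inj₂ (unsettled , first) = no-earlier-pivot-neighbour⇒pivot earlier-not-pivot
      where
      earlier-not-pivot : ∀ {w} → T (adj G v w) → w ≺ v → ¬ IsPivotP G π w
      earlier-not-pivot {w} v~w w≺v pw with T? (settled S w)
      ... | no  ¬sw = ℕ.<-asym w≺v (first v~w ¬sw)
      ... | yes sw with settled⇒near I sw
      ...   | inj₁ p-w             = unsettled (near⇒settled I p-w v~w)
      ...   | inj₂ (q , w~q , p-q) = pivots-independent pw (piv⇒pivot I p-q) w~q

    near : ∀ {v} → T (settled (round G π S) v) →
           T (piv (round G π S) v) ⊎ ∃ λ q → T (adj G v q) × T (piv (round G π S) q)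
    near s′ with round-settled⁻ S s′
    ... | inj₂ fresh = fresh
    ... | inj₁ s with settled⇒near I s
    ...   | inj₁ p               = inj₁ (round-piv⁺ S p)
    ...   | inj₂ (q , v~q , p-q) = inj₂ (q , v~q , round-piv⁺ S p-q)

  RoundInv-rounds : ∀ r → RoundInv (rounds G π r)
  RoundInv-rounds zero    = record
    { piv⇒pivot = λ () ; settled⇒near = λ () ; piv⇒settled = λ () ; near⇒settled = λ () }
  RoundInv-rounds (suc r) = RoundInv-round (RoundInv-rounds r)

  module _ (r : ℕ) where

    rounds-RoundInv : RoundInv (rounds G π r)
    rounds-RoundInv = RoundInv-rounds r

    settled-pivot⇒rPiv : ∀ {p} → IsPivotP G π p → T (rSettled G π r p) → T (rPiv G π r p)
    settled-pivot⇒rPiv pp s with settled⇒near rounds-RoundInv s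
    ... | inj₁ p-p             = p-p
    ... | inj₂ (q , p~q , p-q) = ⊥-elim (pivots-independent pp (piv⇒pivot rounds-RoundInv p-q) p~q)

    pivotNeighbour : Fin n → Fin n → Bool
    pivotNeighbour u q = adj G u q ∧ rPiv G π r q

    earlyUnsettledNeighbour : Fin n → Fin n → Fin n → Bool
    earlyUnsettledNeighbour u m w = adj G u w ∧ not (rSettled G π r w) ∧ _<ʳ_ G π w m

    FirstPivotNeighbour : Fin n → Fin n → Set
    FirstPivotNeighbour u m = findᵇ (pivotNeighbour u) (byRank G π) ≡ just m

    Blocked : Fin n → Fin n → Set
    Blocked u m = T (any (earlyUnsettledNeighbour u m) (allFin n))

    data LabelView (u : Fin n) : Fin n ⊎ Fin n → Set where
      pivot   : T (rPiv G π r u) → LabelView u (inj₁ u)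
      lonely  : ¬ T (rPiv G π r u) → findᵇ (pivotNeighbour u) (byRank G π) ≡ nothing →
                LabelView u (inj₂ u)
      blocked : ∀ {m} → ¬ T (rPiv G π r u) → FirstPivotNeighbour u m → Blocked u m →
                LabelView u (inj₂ u)
      joins   : ∀ {m} → ¬ T (rPiv G π r u) → FirstPivotNeighbour u m → ¬ Blocked u m →
                LabelView u (inj₁ m)

    labelView : ∀ u → LabelView u (rLabel G π r u)
    labelView u with rPiv G π r u in pu
    ... | true  = pivot (from T-≡ pu)
    ... | false with findᵇ (pivotNeighbour u) (byRank G π) in first
    ...   | nothing = lonely (subst T pu) first
    ...   | just m with any (earlyUnsettledNeighbour u m) (allFin n) in early
    ...     | true  = blocked (subst T pu) first (from T-≡ early)
    ...     | false = joins (subst T pu) first (subst T early)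

    firstPivotNeighbour⁻ : ∀ {u m} → FirstPivotNeighbour u m →
      T (adj G u m) × T (rPiv G π r m) × (∀ {q} → T (adj G u q) → T (rPiv G π r q) → m ≼ q)
    firstPivotNeighbour⁻ {u} f =
      let found , first = findᵇ-byRank-just (pivotNeighbour u) f
          u~m , p-m = to T-∧ found
      in u~m , p-m , λ {q} u~q p-q → first q (from T-∧ (u~q , p-q))

    Blocked⁺ : ∀ {u m w} → T (adj G u w) → ¬ T (rSettled G π r w) → w ≺ m → Blocked u m
    Blocked⁺ {u} {m} {w} u~w ¬sw w≺m =
      any⁺ (earlyUnsettledNeighbour u m)
           (lose (∈-allFin w) (from T-∧ (u~w , from T-∧ (¬T⇒T-not ¬sw , ≺⇒<ʳ w≺m))))

    Blocked⁻ : ∀ {u m} → Blocked u m → ∃ λ w → T (adj G u w) × ¬ T (rSettled G π r w) × w ≺ m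
    Blocked⁻ {u} {m} b =
      let w , t = satisfied (any⁻ (earlyUnsettledNeighbour u m) (allFin n) b)
          u~w , rest = to T-∧ t
          ns , w<m = to T-∧ rest
      in w , u~w , T-not⇒¬T ns , <ʳ⇒≺ w<m

    joins⇒pivotOf : ∀ {u m} → FirstPivotNeighbour u m → ¬ Blocked u m → pivotOf G π u ≡ just m
    joins⇒pivotOf {u} {m} f unblocked with firstPivotNeighbour⁻ f | pivotOf-total u
    ... | u~m , p-m , first | p , pu with p ≟ m
    ...   | yes refl = pu
    ...   | no p≢m   = by-status (T? (rSettled G π r p))
      where
      pm : IsPivotP G π m
      pm = piv⇒pivot rounds-RoundInv p-m

      p≺m : p ≺ m
      p≺m = ≼∧≢⇒≺ (pivotOf-min pu pm u~m) p≢m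

      u~p : T (adj G u p)
      u~p = pivotOf-adj-≢ pu (λ { refl → pivots-independent pu pm u~m })

      -- p is a neighbour of u preceding m: settled, it would be an r-pivot chosen before m;
      -- unsettled, it blocks u from joining m.
      by-status : Dec (T (rSettled G π r p)) → pivotOf G π u ≡ just m
      by-status (yes sp)  =
        ⊥-elim (ℕ.<⇒≱ p≺m (first u~p (settled-pivot⇒rPiv (pivotOf-pivot pu) sp)))
      by-status (no  ¬sp) = ⊥-elim (unblocked (Blocked⁺ u~p ¬sp p≺m))

    rLabel-inj₁⇒pivotOf : ∀ {u m} → rLabel G π r u ≡ inj₁ m → pivotOf G π u ≡ just m
    rLabel-inj₁⇒pivotOf {u} = from-view (labelView u)
      where
      from-view : ∀ {l m} → LabelView u l → l ≡ inj₁ m → pivotOf G π u ≡ just m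
      from-view (pivot p-u)           refl = piv⇒pivot rounds-RoundInv p-u
      from-view (joins _ f unblocked) refl = joins⇒pivotOf f unblocked

    rLabel-inj₂ : ∀ {u y} → rLabel G π r u ≡ inj₂ y → y ≡ u
    rLabel-inj₂ {u} = from-view (labelView u)
      where
      from-view : ∀ {l y} → LabelView u l → l ≡ inj₂ y → y ≡ u
      from-view (lonely _ _)    refl = refl
      from-view (blocked _ _ _) refl = refl

    rLabel-inj₂⇒SingletonR : ∀ {u} → rLabel G π r u ≡ inj₂ u → SingletonR G π r u
    rLabel-inj₂⇒SingletonR lu x lx = sym (rLabel-inj₂ (trans lx lu))

    sameLabel⇒SamePivot : ∀ {u v} → u ≢ v → SameR G π r u v → SamePivot G π u v
    sameLabel⇒SamePivot {u} {v} u≢v same with rLabel G π r u in lu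
    ... | inj₁ m = m , rLabel-inj₁⇒pivotOf lu , rLabel-inj₁⇒pivotOf (sym same)
    ... | inj₂ y = ⊥-elim (u≢v (trans (sym (rLabel-inj₂ lu)) (rLabel-inj₂ (sym same))))

    cluster-firstPivotNeighbour : ∀ {x p} → pivotOf G π x ≡ just p → T (rPiv G π r p) → x ≢ p →
                                  FirstPivotNeighbour x p
    cluster-firstPivotNeighbour {x} {p} px p-p x≢p with findᵇ (pivotNeighbour x) (byRank G π) in f
    ... | nothing =
      ⊥-elim (findᵇ-byRank-nothing (pivotNeighbour x) f p (from T-∧ (pivotOf-adj-≢ px x≢p , p-p)))
    ... | just m  =
      let x~m , p-m , first = firstPivotNeighbour⁻ f
      in cong just (≼-antisym (first (pivotOf-adj-≢ px x≢p) p-p)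
                              (pivotOf-min px (piv⇒pivot rounds-RoundInv p-m) x~m))

    JoinsOrBlocked : Fin n → Fin n → Set
    JoinsOrBlocked p x = rLabel G π r x ≡ inj₁ p ⊎ (rLabel G π r x ≡ inj₂ x × Blocked x p)

    rLabel-in-rCluster : ∀ {x p} → pivotOf G π x ≡ just p → T (rPiv G π r p) → JoinsOrBlocked p x
    rLabel-in-rCluster {x} {p} px p-p with x ≟ p
    ... | yes refl = inj₁ (own-label (labelView x))
      where
      own-label : ∀ {l} → LabelView x l → l ≡ inj₁ x
      own-label (pivot _)          = refl
      own-label (lonely ¬p-x _)    = ⊥-elim (¬p-x p-p)
      own-label (blocked ¬p-x _ _) = ⊥-elim (¬p-x p-p)
      own-label (joins ¬p-x _ _)   = ⊥-elim (¬p-x p-p)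
    ... | no x≢p = from-view (labelView x)
      where
      f : FirstPivotNeighbour x p
      f = cluster-firstPivotNeighbour px p-p x≢p

      from-view : ∀ {l} → LabelView x l → l ≡ inj₁ p ⊎ (l ≡ inj₂ x × Blocked x p)
      from-view (pivot p-x)      =
        ⊥-elim (x≢p (just-injective (trans (sym (piv⇒pivot rounds-RoundInv p-x)) px)))
      from-view (lonely _ none)  = ⊥-elim (nothing≢just (trans (sym none) f))
      from-view (blocked _ f′ b) with trans (sym f) f′
      ... | refl = inj₂ (refl , b)
      from-view (joins _ f′ _) with trans (sym f) f′
      ... | refl = inj₁ refl

    Stranded : Fin n → Fin n → Set
    Stranded p x = SingletonR G π r x ×
                   Σ (Fin n) λ w → adj G x w ≡ true × rSettled G π r w ≡ false × ¬ IsPivotP G π w × w ≺ p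

    blocked⇒Stranded : ∀ {x p} → pivotOf G π x ≡ just p → rLabel G π r x ≡ inj₂ x → Blocked x p →
                       Stranded p x
    blocked⇒Stranded px lx b =
      let w , x~w , ¬sw , w≺p = Blocked⁻ b
      in rLabel-inj₂⇒SingletonR lx , w , to T-≡ x~w , to T-not-≡ (¬T⇒T-not ¬sw) ,
         (λ pw → ℕ.<⇒≱ w≺p (pivotOf-min px pw x~w)) , w≺p

    separated-in-cluster : ∀ {u v p} → pivotOf G π u ≡ just p → pivotOf G π v ≡ just p →
      ¬ SameR G π r u v →
      rSettled G π r p ≡ false ⊎ (rSettled G π r p ≡ true × (Stranded p u ⊎ Stranded p v))
    separated-in-cluster {u} {v} {p} pu pv separated with rSettled G π r p in sp
    ... | false = inj₁ refl
    ... | true  = inj₂ (refl , strand (rLabel-in-rCluster pu p-p) (rLabel-in-rCluster pv p-p))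
      where
      p-p : T (rPiv G π r p)
      p-p = settled-pivot⇒rPiv (pivotOf-pivot pu) (from T-≡ sp)

      strand : JoinsOrBlocked p u → JoinsOrBlocked p v → Stranded p u ⊎ Stranded p v
      strand (inj₁ lu)       (inj₁ lv)       = ⊥-elim (separated (trans lu (sym lv)))
      strand (inj₂ (lu , b)) _               = inj₁ (blocked⇒Stranded pu lu b)
      strand (inj₁ _)        (inj₂ (lv , b)) = inj₂ (blocked⇒Stranded pv lv b)

lemma8 : (n : ℕ) (G : Graph n) (π : Permutation′ n) (r : ℕ) → 1 ≤ r →
    (u v : Fin n) → u ≢ v →
    ¬ Agrees G π (SameR G π r) u v → Agrees G π (SamePivot G π) u v →
    adj G u v ≡ true ×
    Σ (Fin n) λ p → pivotOf G π u ≡ just p × pivotOf G π v ≡ just p ×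
      (rSettled G π r p ≡ false
       ⊎ (rSettled G π r p ≡ true ×
          ((SingletonR G π r u × Σ (Fin n) λ w → adj G u w ≡ true × rSettled G π r w ≡ false ×
              ¬ IsPivotP G π w × rank G π w < rank G π p)
           ⊎ (SingletonR G π r v × Σ (Fin n) λ w → adj G v w ≡ true × rSettled G π r w ≡ false ×
              ¬ IsPivotP G π w × rank G π w < rank G π p))))
-- The argument does not use r ≥ 1.
lemma8 n G π r _ u v u≢v disagree (inj₁ (u~v , p , pu , pv)) =
  u~v , p , pu , pv , separated-in-cluster G π r pu pv (λ same → disagree (inj₁ (u~v , same)))
lemma8 n G π r _ u v u≢v disagree (inj₂ (u≁v , separated)) =
  ⊥-elim (separated (sameLabel⇒SamePivot G π r u≢v same))
  where
  same : SameR G π r u v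
  same = decidable-stable (≡-dec _≟_ _≟_ (rLabel G π r u) (rLabel G π r v))
                          (λ ¬same → disagree (inj₂ (u≁v , ¬same)))
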